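{- Let $k\ge1$ and $W_\mathcal{A}^k=\ker(\theta_L-\theta_R)\subseteq V_\mathcal{A}^k$. For every circular string $\omega$ over $\mathcal{A}$, its $k$-mer count tensor $\psi_k(\omega)$ lies in $W_\mathcal{A}^k$.
   Context: $\mathcal{A}$ is a finite alphabet with $q$ letters, $V_\mathcal{A}=\mathbb{C}^q$ with standard basis $\{e_a\}_{a\in\mathcal A}$, $V_\mathcal{A}^m$ its $m$-fold tensor power ($V_\mathcal A^0=\mathbb C$). $f_0=q^{ -1/2}\sum_a e_a$. For $m\ge1$, $\theta_L,\theta_R:V_\mathcal{A}^m\to V_\mathcal{A}^{m-1}$ are the linear maps with $\theta_L(v_1\otimes\cdots\otimes v_m)=\langle f_0,v_1\rangle v_2\otimes\cdots\otimes v_m$ and $\theta_R(v_1\otimes\cdots\otimes v_m)=\langle f_0,v_m\rangle v_1\otimes\cdots\otimes v_{m-1}$ (so on standard basis tensors they delete the first, resp. last, letter and multiply by $q^{ -1/2}$). A circular string of length $n\ge1$ is a string $\omega=\omega_0\cdots\omega_{n-1}$ over $\mathcal{A}$ regarded as representing the periodic infinite string $\omega_0\cdots\omega_{n-1}\omega_0\omega_1\cdots$. Its $k$-mer count tensor is $\psi_k(\omega)=\sum_{t=0}^{n-1}e_{\omega_t}\otimes e_{\omega_{t+1}}\otimes\cdots\otimes e_{\omega_{t+k-1}}\in V_\mathcal{A}^k$, indices taken modulo $n$ (i.e. the coefficient of each $k$-mer basis tensor is its number of occurrences in $\omega$). -}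

module Defs where

open import Data.Nat using (ℕ; zero; suc)
import Data.Nat as ℕ
open import Data.Nat.DivMod using (_mod_)
open import Data.Fin using (Fin; toℕ)
import Data.Fin as Fin
open import Data.Vec using (Vec; _∷_; _∷ʳ_; tabulate)
open import Data.Vec.Properties using (≡-dec)
open import Data.Integer using (ℤ; _+_; _-_; 0ℤ; 1ℤ)
open import Relation.Nullary using (yes; no)
open import Relation.Binary.PropositionalEquality using (_≡_)

Word : ℕ → ℕ → Set
Word q m = Vec (Fin q) m

-- An element of V_A^m = (C^q)^{⊗m}, written in the standard basis
-- e_{a1} ⊗ ... ⊗ e_{am}: its coefficient function on words of length m.
-- Coefficients are taken in ℤ.
Tensor : ℕ → ℕ → Set
Tensor q m = Word q m → ℤ

sumFin : ∀ {q} → (Fin q → ℤ) → ℤ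
sumFin {zero}  f = 0ℤ
sumFin {suc q} f = f Fin.zero + sumFin (λ a → f (Fin.suc a))

-- θ_L and θ_R with the common scalar factor q^{-1/2} removed:
-- (θL T)(w) = Σ_a T(a w),  (θR T)(w) = Σ_a T(w a).
θL : ∀ {q m} → Tensor q (suc m) → Tensor q m
θL T w = sumFin (λ a → T (a ∷ w))

θR : ∀ {q m} → Tensor q (suc m) → Tensor q m
θR T w = sumFin (λ a → T (w ∷ʳ a))

InW : ∀ {q m} → Tensor q (suc m) → Set
InW {q} {m} T = ∀ (w : Word q m) → θL T w - θR T w ≡ 0ℤ

-- A circular string of length n+1 ≥ 1: ω_0 ... ω_n.
CircString : ℕ → ℕ → Set
CircString q n = Fin (suc n) → Fin q

window : ∀ {q n} (k : ℕ) → CircString q n → Fin (suc n) → Word q k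
window {n = n} k ω t = tabulate (λ i → ω ((toℕ t ℕ.+ toℕ i) mod (suc n)))

sumPos : ∀ {n} → (Fin n → ℤ) → ℤ
sumPos = sumFin

-- The k-mer count tensor ψ_k(ω) = Σ_t e_{ω_t} ⊗ ... ⊗ e_{ω_{t+k-1}}:
-- coefficient at w is the number of t with window_t = w.
ψ : ∀ {q n} (k : ℕ) → CircString q n → Tensor q k
ψ k ω w = sumPos (λ t → indicator (≡-dec Fin._≟_ (window k ω t) w))
  where
  indicator : ∀ {P : Set} → Relation.Nullary.Dec P → ℤ
  indicator (yes _) = 1ℤ
  indicator (no _)  = 0ℤ

-- Each length-(m+1) window of ω determines two length-m windows: dropping its last
-- letter gives the window at the same position t, dropping its first letter the window
-- at t+1 (mod n+1). Summing the occurrence counts over the dropped letter therefore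
-- turns both θ_R ψ_{m+1}(ω) and θ_L ψ_{m+1}(ω) into ψ_m(ω); for θ_L this needs the
-- reindexing t ↦ t+1, a bijection of the positions exactly because ω is circular.
module Submission where

open import Defs
import Algebra.Properties.CommutativeMonoid.Sum as Sum
open import Data.Fin using (Fin; toℕ; inject₁; fromℕ)
open import Data.Fin.Properties using (toℕ-injective; toℕ-inject₁; toℕ-fromℕ; toℕ-fromℕ<; toℕ<n; punchInᵢ≢i)
import Data.Fin as Fin
open import Data.Integer using (ℤ; _+_; _-_; 0ℤ; 1ℤ)
open import Data.Integer.Properties using (+-0-commutativeMonoid; +-comm; +-identityʳ; +-inverseʳ)
open import Data.Nat as ℕ using (ℕ; zero; suc; s≤s; NonZero)
open import Data.Nat.DivMod using (_mod_; _%_; %-distribˡ-+; m%n%n≡m%n; m<n⇒m%n≡m; n%n≡0; m%n<n)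
open import Data.Nat.Properties using (+-suc)
open import Data.Product using (_×_; proj₁; proj₂; swap)
open import Data.Vec using (_∷_; _∷ʳ_; tabulate)
open import Data.Vec.Properties using (≡-dec; ∷-injective; ∷ʳ-injective; tabulate-cong)
open import Function using (_∘_)
open import Relation.Nullary using (Dec; yes; no; ¬_; contradiction)
open import Relation.Binary.Definitions using (DecidableEquality)
open import Relation.Binary.PropositionalEquality

open Sum +-0-commutativeMonoid
  using (sum; sum-syntax; sum-cong-≗; sum-replicate-zero; sum-init-last; sum-remove; ∑-comm)

sumFin≡sum : ∀ {n} (f : Fin n → ℤ) → sumFin f ≡ sum f
sumFin≡sum {zero}  f = refl
sumFin≡sum {suc n} f = cong (f Fin.zero +_) (sumFin≡sum (f ∘ Fin.suc))

sum-zero : ∀ {n} {f : Fin n → ℤ} → (∀ a → f a ≡ 0ℤ) → sum f ≡ 0ℤ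
sum-zero {n} f≡0 = trans (sum-cong-≗ f≡0) (sum-replicate-zero n)

sum-supported-at : ∀ {n} (x : Fin n) (f : Fin n → ℤ) → (∀ a → a ≢ x → f a ≡ 0ℤ) → sum f ≡ f x
sum-supported-at {suc _} x f f≡0 = begin
  sum f                          ≡⟨ sum-remove f ⟩
  f x + sum (f ∘ Fin.punchIn x)  ≡⟨ cong (f x +_) (sum-zero (λ a → f≡0 _ (punchInᵢ≢i x a))) ⟩
  f x + 0ℤ                       ≡⟨ +-identityʳ (f x) ⟩
  f x                            ∎
  where open ≡-Reasoning

indicator : ∀ {P : Set} → Dec P → ℤ
indicator (yes _) = 1ℤ
indicator (no _)  = 0ℤ

indicator-yes : ∀ {P : Set} (P? : Dec P) → P → indicator P? ≡ 1ℤ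
indicator-yes (yes _) _ = refl
indicator-yes (no ¬p) p = contradiction p ¬p

indicator-no : ∀ {P : Set} (P? : Dec P) → ¬ P → indicator P? ≡ 0ℤ
indicator-no (yes p) ¬p = contradiction p ¬p
indicator-no (no _)  _  = refl

module _ {n} {B C : Set} (_≟ᴮ_ : DecidableEquality B) (_≟ᶜ_ : DecidableEquality C)
         (_⊕_ : Fin n → B → C)
         (⊕-injective : ∀ {a a′ v w} → a ⊕ v ≡ a′ ⊕ w → a ≡ a′ × v ≡ w) where

  ∑-indicator-injective₂ : ∀ x v w → ∑[ a < n ] indicator ((x ⊕ v) ≟ᶜ (a ⊕ w)) ≡ indicator (v ≟ᴮ w)
  ∑-indicator-injective₂ x v w with v ≟ᴮ w
  ... | no v≢w   = sum-zero (λ a → indicator-no ((x ⊕ v) ≟ᶜ (a ⊕ w)) (v≢w ∘ proj₂ ∘ ⊕-injective))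
  ... | yes refl = begin
    ∑[ a < n ] indicator ((x ⊕ v) ≟ᶜ (a ⊕ v))  ≡⟨ sum-supported-at x _ vanishes-off-x ⟩
    indicator ((x ⊕ v) ≟ᶜ (x ⊕ v))              ≡⟨ indicator-yes ((x ⊕ v) ≟ᶜ (x ⊕ v)) refl ⟩
    1ℤ                                          ∎
    where
    open ≡-Reasoning
    vanishes-off-x : ∀ a → a ≢ x → indicator ((x ⊕ v) ≟ᶜ (a ⊕ v)) ≡ 0ℤ
    vanishes-off-x a a≢x = indicator-no ((x ⊕ v) ≟ᶜ (a ⊕ v)) (a≢x ∘ sym ∘ proj₁ ∘ ⊕-injective)

infix 4 _≟ʷ_
_≟ʷ_ : ∀ {q k} → DecidableEquality (Word q k)
_≟ʷ_ = ≡-dec Fin._≟_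

∑-indicator-∷ : ∀ {q m} (x : Fin q) (v w : Word q m) →
                ∑[ a < q ] indicator (x ∷ v ≟ʷ a ∷ w) ≡ indicator (v ≟ʷ w)
∑-indicator-∷ = ∑-indicator-injective₂ _≟ʷ_ _≟ʷ_ _∷_ ∷-injective

∑-indicator-∷ʳ : ∀ {q m} (x : Fin q) (v w : Word q m) →
                 ∑[ a < q ] indicator (v ∷ʳ x ≟ʷ w ∷ʳ a) ≡ indicator (v ≟ʷ w)
∑-indicator-∷ʳ = ∑-indicator-injective₂ _≟ʷ_ _≟ʷ_ (λ a v → v ∷ʳ a) (swap ∘ ∷ʳ-injective _ _)

-- The summand of ψ is an indicator local to ψ in Defs and cannot be named here, so
-- ψ-summand-as-indicator leaves it as `_`, inferred from its uses in ψ-as-sum. Those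
-- uses split off the summand at position 0, so that the remaining sum has variable
-- length n and does not unfold, which is what lets that inference succeed.
mutual
  ψ-as-sum : ∀ {q n} k (ω : CircString q n) (w : Word q k) →
             ψ k ω w ≡ ∑[ t < suc n ] indicator (window k ω t ≟ʷ w)
  ψ-as-sum {n = n} k ω w with window k ω Fin.zero ≟ʷ w
  ... | yes _ = cong (1ℤ +_) (trans (sumFin≡sum {n} _) (sum-cong-≗ (ψ-summand-as-indicator k ω w)))
  ... | no _  = cong (0ℤ +_) (trans (sumFin≡sum {n} _) (sum-cong-≗ (ψ-summand-as-indicator k ω w)))

  ψ-summand-as-indicator : ∀ {q n} k (ω : CircString q n) (w : Word q k) (a : Fin n) →
                           _ ≡ indicator (window k ω (Fin.suc a) ≟ʷ w)
  ψ-summand-as-indicator k ω w a with window k ω (Fin.suc a) ≟ʷ w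
  ... | yes _ = refl
  ... | no _  = refl

[m%n+k]%n≡[m+k]%n : ∀ m k n .{{_ : NonZero n}} → (m % n ℕ.+ k) % n ≡ (m ℕ.+ k) % n
[m%n+k]%n≡[m+k]%n m k n = begin
  (m % n ℕ.+ k) % n          ≡⟨ %-distribˡ-+ (m % n) k n ⟩
  (m % n % n ℕ.+ k % n) % n  ≡⟨ cong (λ x → (x ℕ.+ k % n) % n) (m%n%n≡m%n m n) ⟩
  (m % n ℕ.+ k % n) % n      ≡⟨ %-distribˡ-+ m k n ⟨
  (m ℕ.+ k) % n              ∎
  where open ≡-Reasoning

next : ∀ {n} → Fin (suc n) → Fin (suc n)
next {n} t = suc (toℕ t) mod suc n

next-inject₁ : ∀ {n} (i : Fin n) → next (inject₁ i) ≡ Fin.suc i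
next-inject₁ {n} i = toℕ-injective (begin
  toℕ (next (inject₁ i))         ≡⟨ toℕ-fromℕ< _ ⟩
  suc (toℕ (inject₁ i)) % suc n  ≡⟨ cong (λ j → suc j % suc n) (toℕ-inject₁ i) ⟩
  suc (toℕ i) % suc n            ≡⟨ m<n⇒m%n≡m (s≤s (toℕ<n i)) ⟩
  suc (toℕ i)                    ∎)
  where open ≡-Reasoning

next-fromℕ : ∀ n → next (fromℕ n) ≡ Fin.zero
next-fromℕ n = toℕ-injective (begin
  toℕ (next (fromℕ n))         ≡⟨ toℕ-fromℕ< _ ⟩
  suc (toℕ (fromℕ n)) % suc n  ≡⟨ cong (λ j → suc j % suc n) (toℕ-fromℕ n) ⟩
  suc n % suc n                ≡⟨ n%n≡0 (suc n) ⟩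
  0                            ∎)
  where open ≡-Reasoning

next-+-mod : ∀ {n} (t : Fin (suc n)) j →
             (toℕ (next t) ℕ.+ j) mod suc n ≡ (suc (toℕ t) ℕ.+ j) mod suc n
next-+-mod {n} t j = toℕ-injective (begin
  toℕ ((toℕ (next t) ℕ.+ j) mod suc n)  ≡⟨ toℕ-fromℕ< _ ⟩
  (toℕ (next t) ℕ.+ j) % suc n          ≡⟨ cong (λ x → (x ℕ.+ j) % suc n) (toℕ-fromℕ< (m%n<n (suc (toℕ t)) (suc n))) ⟩
  (suc (toℕ t) % suc n ℕ.+ j) % suc n   ≡⟨ [m%n+k]%n≡[m+k]%n (suc (toℕ t)) j (suc n) ⟩
  (suc (toℕ t) ℕ.+ j) % suc n           ≡⟨ toℕ-fromℕ< _ ⟨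
  toℕ ((suc (toℕ t) ℕ.+ j) mod suc n)   ∎)
  where open ≡-Reasoning

sum-next : ∀ {n} (f : Fin (suc n) → ℤ) → ∑[ t < suc n ] f (next t) ≡ sum f
sum-next {n} f = begin
  ∑[ t < suc n ] f (next t)                             ≡⟨ sum-init-last (f ∘ next) ⟩
  ∑[ i < n ] f (next (inject₁ i)) + f (next (fromℕ n))  ≡⟨ cong₂ _+_ (sum-cong-≗ (cong f ∘ next-inject₁))
                                                                    (cong f (next-fromℕ n)) ⟩
  ∑[ i < n ] f (Fin.suc i) + f Fin.zero                 ≡⟨ +-comm _ (f Fin.zero) ⟩
  sum f                                                 ∎
  where open ≡-Reasoning

tabulate-∷ʳ : ∀ {A : Set} {m} (f : Fin (suc m) → A) → tabulate f ≡ tabulate (f ∘ inject₁) ∷ʳ f (fromℕ m)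
tabulate-∷ʳ {m = zero}  f = refl
tabulate-∷ʳ {m = suc m} f = cong (f Fin.zero ∷_) (tabulate-∷ʳ (f ∘ Fin.suc))

window-suc-∷ : ∀ {q n} m (ω : CircString q n) t →
               window (suc m) ω t ≡ ω ((toℕ t ℕ.+ 0) mod suc n) ∷ window m ω (next t)
window-suc-∷ {n = n} m ω t = cong (_ ∷_) (tabulate-cong (λ i → cong ω (begin
  (toℕ t ℕ.+ suc (toℕ i)) mod suc n   ≡⟨ cong (_mod suc n) (+-suc (toℕ t) (toℕ i)) ⟩
  (suc (toℕ t) ℕ.+ toℕ i) mod suc n   ≡⟨ next-+-mod t (toℕ i) ⟨
  (toℕ (next t) ℕ.+ toℕ i) mod suc n  ∎)))
  where open ≡-Reasoning

window-suc-∷ʳ : ∀ {q n} m (ω : CircString q n) t →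
                window (suc m) ω t ≡ window m ω t ∷ʳ ω ((toℕ t ℕ.+ m) mod suc n)
window-suc-∷ʳ {q} {n} m ω t = trans (tabulate-∷ʳ (letter ∘ toℕ))
  (cong₂ _∷ʳ_ (tabulate-cong (cong letter ∘ toℕ-inject₁)) (cong letter (toℕ-fromℕ m)))
  where
  letter : ℕ → Fin q
  letter j = ω ((toℕ t ℕ.+ j) mod suc n)

θL-ψ : ∀ {q n} m (ω : CircString q n) (w : Word q m) → θL (ψ (suc m) ω) w ≡ ψ m ω w
θL-ψ {q} {n} m ω w = begin
  θL (ψ (suc m) ω) w
    ≡⟨ sumFin≡sum (λ a → ψ (suc m) ω (a ∷ w)) ⟩
  ∑[ a < q ] ψ (suc m) ω (a ∷ w)
    ≡⟨ sum-cong-≗ (λ a → ψ-as-sum (suc m) ω (a ∷ w)) ⟩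
  ∑[ a < q ] ∑[ t < suc n ] indicator (window (suc m) ω t ≟ʷ a ∷ w)
    ≡⟨ ∑-comm (λ a t → indicator (window (suc m) ω t ≟ʷ a ∷ w)) ⟩
  ∑[ t < suc n ] ∑[ a < q ] indicator (window (suc m) ω t ≟ʷ a ∷ w)
    ≡⟨ sum-cong-≗ drop-first-letter ⟩
  ∑[ t < suc n ] indicator (window m ω (next t) ≟ʷ w)
    ≡⟨ sum-next (λ t → indicator (window m ω t ≟ʷ w)) ⟩
  ∑[ t < suc n ] indicator (window m ω t ≟ʷ w)
    ≡⟨ ψ-as-sum m ω w ⟨
  ψ m ω w
    ∎
  where
  open ≡-Reasoning
  drop-first-letter : ∀ t → ∑[ a < q ] indicator (window (suc m) ω t ≟ʷ a ∷ w)
                            ≡ indicator (window m ω (next t) ≟ʷ w)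
  drop-first-letter t = trans (cong (λ u → ∑[ a < q ] indicator (u ≟ʷ a ∷ w)) (window-suc-∷ m ω t))
                              (∑-indicator-∷ _ (window m ω (next t)) w)

θR-ψ : ∀ {q n} m (ω : CircString q n) (w : Word q m) → θR (ψ (suc m) ω) w ≡ ψ m ω w
θR-ψ {q} {n} m ω w = begin
  θR (ψ (suc m) ω) w
    ≡⟨ sumFin≡sum (λ a → ψ (suc m) ω (w ∷ʳ a)) ⟩
  ∑[ a < q ] ψ (suc m) ω (w ∷ʳ a)
    ≡⟨ sum-cong-≗ (λ a → ψ-as-sum (suc m) ω (w ∷ʳ a)) ⟩
  ∑[ a < q ] ∑[ t < suc n ] indicator (window (suc m) ω t ≟ʷ w ∷ʳ a)
    ≡⟨ ∑-comm (λ a t → indicator (window (suc m) ω t ≟ʷ w ∷ʳ a)) ⟩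
  ∑[ t < suc n ] ∑[ a < q ] indicator (window (suc m) ω t ≟ʷ w ∷ʳ a)
    ≡⟨ sum-cong-≗ drop-last-letter ⟩
  ∑[ t < suc n ] indicator (window m ω t ≟ʷ w)
    ≡⟨ ψ-as-sum m ω w ⟨
  ψ m ω w
    ∎
  where
  open ≡-Reasoning
  drop-last-letter : ∀ t → ∑[ a < q ] indicator (window (suc m) ω t ≟ʷ w ∷ʳ a)
                           ≡ indicator (window m ω t ≟ʷ w)
  drop-last-letter t = trans (cong (λ u → ∑[ a < q ] indicator (u ≟ʷ w ∷ʳ a)) (window-suc-∷ʳ m ω t))
                             (∑-indicator-∷ʳ _ (window m ω t) w)

mainTheorem4 : (q n m : ℕ) (ω : CircString q n) → InW (ψ (suc m) ω)
mainTheorem4 q n m ω w = begin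
  θL (ψ (suc m) ω) w - θR (ψ (suc m) ω) w  ≡⟨ cong₂ _-_ (θL-ψ m ω w) (θR-ψ m ω w) ⟩
  ψ m ω w - ψ m ω w                        ≡⟨ +-inverseʳ (ψ m ω w) ⟩
  0ℤ                                       ∎
  where open ≡-Reasoning
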